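{- Let $G$ be a subgraph of the complete bipartite graph with parts $X$ and $Y$, where $|X|=m\ge 9$ and $|Y|=n\ge 9$. If some vertex $x\in X$ has $\deg_G(x)\ge 7$, then either $G$ contains a copy of $K_{2,2}$ or $\overline{G}$ contains a copy of $K_{4,4}$.
   Context: $\overline{G}$ denotes the bipartite complement of $G$, i.e. the graph on $X\cup Y$ whose edges are the edges $xy$ ($x\in X$, $y\in Y$) not in $G$. -}

module Defs where

open import Data.Bool using (Bool; true; false; not; if_then_else_)
open import Data.Nat using (ℕ)
open import Data.Fin using (Fin)
open import Data.List using (List; map; allFin)
open import Data.Nat.ListAction using (sum)
open import Data.Product using (Σ; _×_)
open import Function.Definitions using (Injective)
open import Relation.Binary.PropositionalEquality using (_≡_)

-- A bipartite graph with parts X = Fin m and Y = Fin n, i.e. a subgraph of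
-- K_{m,n}, given by its (decidable) bipartite adjacency relation.
BipGraph : ℕ → ℕ → Set
BipGraph m n = Fin m → Fin n → Bool

complement : ∀ {m n} → BipGraph m n → BipGraph m n
complement G x y = not (G x y)

deg : ∀ {m n} → BipGraph m n → Fin m → ℕ
deg {n = n} G x = sum (map (λ y → if G x y then 1 else 0) (allFin n))

ContainsK : ∀ {m n} → ℕ → ℕ → BipGraph m n → Set
ContainsK {m} {n} s t G =
  Σ (Fin s → Fin m) λ f → Σ (Fin t → Fin n) λ g →
    Injective _≡_ _≡_ f × Injective _≡_ _≡_ g × (∀ i j → G (f i) (g j) ≡ true)

-- Fix 7 neighbours y₀,…,y₆ of x and 8 further vertices of X. If one of these
-- sees two of the yⱼ, those two yⱼ, it and x span a K₂,₂. Otherwise each sees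
-- at most one yⱼ; label it by that yⱼ. Pigeonhole (8 vertices, 7 labels) gives
-- two with the same label, so some 4 of them carry at most 3 labels, and 4 of
-- the remaining 7 − 3 yⱼ span with them a K₄,₄ of the complement.
module Submission where

open import Defs
open import Data.Bool using (Bool; true; false; not; if_then_else_; _∧_)
import Data.Bool.Properties as Bool
open import Data.Empty using (⊥-elim)
open import Data.Fin using (Fin; zero; suc; punchIn)
open import Data.Fin.Properties
  using (_≟_; any?; suc-injective; punchIn-injective; punchInᵢ≢i; pigeonhole; <⇒≢)
open import Data.List using (tabulate)
open import Data.List.Properties using (map-tabulate)
open import Data.Nat using (ℕ; zero; suc; pred; _≤_; _<_; _∸_; s≤s)
open import Data.Nat.ListAction using (sum)
open import Data.Nat.Properties
  using (≤-refl; ≤-pred; m≤m+n; <⇒≤; ≤-trans; ≤-reflexive; n≤1+n; +-monoʳ-≤; +-suc; ∸-monoˡ-≤;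
         pred-mono-≤; pred[m∸n]≡m∸[1+n]; module ≤-Reasoning)
open import Data.Product using (Σ; _×_; _,_; proj₁; proj₂)
open import Data.Sum using (_⊎_; inj₁; inj₂)
open import Data.Vec.Functional using ([]; _∷_)
open import Function using (_∘_)
open import Function.Definitions using (Injective)
open import Relation.Binary.PropositionalEquality
  using (_≡_; _≢_; refl; sym; trans; cong)
open import Relation.Nullary using (does; yes; no; ¬?)
open import Relation.Nullary.Decidable using (_×-dec_; decidable-stable)

count : ∀ {n} → (Fin n → Bool) → ℕ
count P = sum (tabulate (λ y → if P y then 1 else 0))

deg≡count : ∀ {m n} (G : BipGraph m n) x → deg G x ≡ count (G x)
deg≡count {n = n} G x = cong sum (map-tabulate {n = n} (λ y → y) _)

count-true : ∀ n → count {n} (λ _ → true) ≡ n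
count-true zero    = refl
count-true (suc n) = cong suc (count-true n)

count≤1+count-∧-≢ : ∀ {n} (P : Fin n → Bool) p →
                     count P ≤ suc (count (λ y → not (does (y ≟ p)) ∧ P y))
count≤1+count-∧-≢ {suc n} P zero with P zero
... | true  = ≤-refl
... | false = n≤1+n _
count≤1+count-∧-≢ {suc n} P (suc p) =
  ≤-trans (+-monoʳ-≤ b (count≤1+count-∧-≢ (P ∘ suc) p)) (≤-reflexive (+-suc b _))
  where b = if P zero then 1 else 0

outside : ∀ {k n} → (Fin k → Fin n) → Fin n → Bool
outside {zero}  ps y = true
outside {suc k} ps y = not (does (y ≟ ps zero)) ∧ outside (ps ∘ suc) y

outside⇒≢ : ∀ {k n} (ps : Fin k → Fin n) {y} → outside ps y ≡ true → ∀ i → y ≢ ps i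
outside⇒≢ {suc k} ps {y} out i with y ≟ ps zero | out
outside⇒≢ ps out zero    | no y≢p | _    = y≢p
outside⇒≢ ps out (suc i) | no _   | rest = outside⇒≢ (ps ∘ suc) rest i

count-outside : ∀ {k n} (ps : Fin k → Fin n) → n ∸ k ≤ count (outside ps)
count-outside {zero}  {n} ps = ≤-reflexive (sym (count-true n))
count-outside {suc k} {n} ps = begin
  n ∸ suc k                          ≡⟨ pred[m∸n]≡m∸[1+n] n k ⟨
  pred (n ∸ k)                       ≤⟨ pred-mono-≤ (count-outside (ps ∘ suc)) ⟩
  pred (count (outside (ps ∘ suc)))  ≤⟨ pred-mono-≤ (count≤1+count-∧-≢ _ (ps zero)) ⟩
  count (outside ps)                 ∎
  where open ≤-Reasoning

Injective-∷ : ∀ {A : Set} {n} {a : A} {f : Fin n → A} →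
              Injective _≡_ _≡_ f → (∀ i → a ≢ f i) → Injective _≡_ _≡_ (a ∷ f)
Injective-∷ f-inj a∉f {zero}  {zero}  _ = refl
Injective-∷ f-inj a∉f {zero}  {suc j} e = ⊥-elim (a∉f j e)
Injective-∷ f-inj a∉f {suc i} {zero}  e = ⊥-elim (a∉f i (sym e))
Injective-∷ f-inj a∉f {suc i} {suc j} e = cong suc (f-inj e)

[]-injective : ∀ {A : Set} → Injective _≡_ _≡_ ([] {A = A})
[]-injective {x = ()}

Choice : ∀ {n} → ℕ → (Fin n → Bool) → Set
Choice {n} k P = Σ (Fin k → Fin n) λ f → Injective _≡_ _≡_ f × (∀ i → P (f i) ≡ true)

choose : ∀ {n k} (P : Fin n → Bool) → k ≤ count P → Choice k P
choose {k = zero} P _ = [] , []-injective , λ ()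
choose {suc n} {suc k} P k<count with P zero in P₀
... | false
  with f , f-inj , Pf ← choose (P ∘ suc) k<count
  = suc ∘ f , f-inj ∘ suc-injective , Pf
... | true
  with f , f-inj , Pf ← choose (P ∘ suc) (≤-pred k<count)
  = zero ∷ suc ∘ f , Injective-∷ (f-inj ∘ suc-injective) (λ _ ()) , λ { zero → P₀ ; (suc i) → Pf i }

restrict : ∀ {m n s t} → BipGraph m n → (Fin s → Fin m) → (Fin t → Fin n) → BipGraph s t
restrict G a b i j = G (a i) (b j)

ContainsK-restrict : ∀ {m n s t k l} {G : BipGraph m n} {a : Fin s → Fin m} {b : Fin t → Fin n} →
                     Injective _≡_ _≡_ a → Injective _≡_ _≡_ b →
                     ContainsK k l (restrict G a b) → ContainsK k l G
ContainsK-restrict {a = a} {b} a-inj b-inj (f , g , f-inj , g-inj , edge) =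
  a ∘ f , b ∘ g , f-inj ∘ a-inj , g-inj ∘ b-inj , edge

containsK₂₂ : ∀ {m n} {G : BipGraph m n} {x x′ y y′} → x ≢ x′ → y ≢ y′ →
              G x y ≡ true → G x y′ ≡ true → G x′ y ≡ true → G x′ y′ ≡ true →
              ContainsK 2 2 G
containsK₂₂ {x = x} {x′} {y} {y′} x≢x′ y≢y′ xy xy′ x′y x′y′ =
  x ∷ x′ ∷ [] , y ∷ y′ ∷ [] ,
  Injective-∷ (Injective-∷ []-injective λ ()) (λ { zero → x≢x′ }) ,
  Injective-∷ (Injective-∷ []-injective λ ()) (λ { zero → y≢y′ }) ,
  λ { zero zero → xy ; zero (suc zero) → xy′ ; (suc zero) zero → x′y ; (suc zero) (suc zero) → x′y′ }

TwoNeighbours : ∀ {s t} → BipGraph s t → Set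
TwoNeighbours {s} {t} H =
  Σ (Fin s) λ i → Σ (Fin t) λ j → Σ (Fin t) λ k → j ≢ k × H i j ≡ true × H i k ≡ true

AtMostOneNeighbour : ∀ {s t} → BipGraph s t → Set
AtMostOneNeighbour H = ∀ i {j k} → H i j ≡ true → H i k ≡ true → j ≡ k

twoNeighbours⊎atMostOneNeighbour : ∀ {s t} (H : BipGraph s t) →
                                   TwoNeighbours H ⊎ AtMostOneNeighbour H
twoNeighbours⊎atMostOneNeighbour H
  with any? (λ i → any? λ j → any? λ k →
               ¬? (j ≟ k) ×-dec H i j Bool.≟ true ×-dec H i k Bool.≟ true)
... | yes two = inj₁ two
... | no ¬two = inj₂ λ i {j} {k} Hij Hik →
  decidable-stable (j ≟ k) λ j≢k → ¬two (i , j , k , j≢k , Hij , Hik)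

labelling : ∀ {s t} {H : BipGraph s (suc t)} → AtMostOneNeighbour H →
            Σ (Fin s → Fin (suc t)) λ ℓ → ∀ {i j} → H i j ≡ true → j ≡ ℓ i
labelling {t = t} {H} unique = proj₁ ∘ label , λ {i} → proj₂ (label i)
  where
  label : ∀ i → Σ (Fin (suc t)) λ l → ∀ {j} → H i j ≡ true → j ≡ l
  label i with any? (λ j → H i j Bool.≟ true)
  ... | yes (l , Hil) = l , λ Hij → unique i Hij Hil
  ... | no  ¬any      = zero , λ {j} Hij → ⊥-elim (¬any (j , Hij))

fourRowsWithRepeatedLabel : ∀ {s t} → t < s → 4 ≤ s → (ℓ : Fin s → Fin t) →
                            Σ (Fin 4 → Fin s) λ F → Injective _≡_ _≡_ F × ℓ (F zero) ≡ ℓ (F (suc zero))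
fourRowsWithRepeatedLabel t<s 4≤s ℓ
  with i , i′ , i<i′ , ℓi≡ℓi′ ← pigeonhole t<s ℓ
  with h , h-inj , h-out ← choose (outside (i ∷ i′ ∷ []))
                                  (≤-trans (∸-monoˡ-≤ 2 4≤s) (count-outside (i ∷ i′ ∷ [])))
  = i ∷ i′ ∷ h , Injective-∷ (Injective-∷ h-inj i′∉h) i∉i′∷h , ℓi≡ℓi′
  where
  i′∉h : ∀ u → i′ ≢ h u
  i′∉h u = outside⇒≢ (i ∷ i′ ∷ []) (h-out u) (suc zero) ∘ sym
  i∉i′∷h : ∀ u → i ≢ (i′ ∷ h) u
  i∉i′∷h zero    = <⇒≢ i<i′
  i∉i′∷h (suc u) = outside⇒≢ (i ∷ i′ ∷ []) (h-out u) zero ∘ sym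

independent4×4 : ∀ {s t} → t < s → 7 ≤ t → (ℓ : Fin s → Fin t) →
                 Σ (Fin 4 → Fin s) λ F → Σ (Fin 4 → Fin t) λ C →
                 Injective _≡_ _≡_ F × Injective _≡_ _≡_ C × (∀ u v → C v ≢ ℓ (F u))
independent4×4 t<s 7≤t ℓ
  with F , F-inj , ℓF₀≡ℓF₁ ← fourRowsWithRepeatedLabel t<s
                                (≤-trans (m≤m+n 4 3) (≤-trans 7≤t (<⇒≤ t<s))) ℓ
  with C , C-inj , C-out ← choose (outside (ℓ ∘ F ∘ suc))
                                  (≤-trans (∸-monoˡ-≤ 3 7≤t) (count-outside (ℓ ∘ F ∘ suc)))
  = F , C , F-inj , C-inj , C∉ℓF
  where
  C∉ℓF : ∀ u v → C v ≢ ℓ (F u)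
  C∉ℓF zero    v e = outside⇒≢ (ℓ ∘ F ∘ suc) (C-out v) zero (trans e ℓF₀≡ℓF₁)
  C∉ℓF (suc u) v   = outside⇒≢ (ℓ ∘ F ∘ suc) (C-out v) u

containsK₄₄-complement : ∀ {s t} {H : BipGraph s t} → t < s → 7 ≤ t → (ℓ : Fin s → Fin t) →
                         (∀ {i j} → H i j ≡ true → j ≡ ℓ i) → ContainsK 4 4 (complement H)
containsK₄₄-complement t<s 7≤t ℓ H⊆ℓ
  with F , C , F-inj , C-inj , C∉ℓF ← independent4×4 t<s 7≤t ℓ
  = F , C , F-inj , C-inj , λ u v →
    sym (Bool.¬-not λ H≡true → C∉ℓF u v (H⊆ℓ (sym H≡true)))

lemma3 : (m n : ℕ) → 9 ≤ m → 9 ≤ n → (G : BipGraph m n) →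
    Σ (Fin m) (λ x → 7 ≤ deg G x) →
    ContainsK 2 2 G ⊎ ContainsK 4 4 (complement G)
lemma3 (suc m) n (s≤s 8≤m) _ G (x , 7≤deg)
  with y , y-inj , xy ← choose (G x) (≤-trans 7≤deg (≤-reflexive (deg≡count G x)))
  with twoNeighbours⊎atMostOneNeighbour (restrict G (punchIn x) y)
... | inj₁ (i , j , k , j≢k , Hij , Hik) =
  inj₁ (containsK₂₂ {G = G} (punchInᵢ≢i x i ∘ sym) (j≢k ∘ y-inj) (xy j) (xy k) Hij Hik)
... | inj₂ unique with ℓ , H⊆ℓ ← labelling unique =
  inj₂ (ContainsK-restrict {G = complement G} (punchIn-injective x _ _) y-inj
          (containsK₄₄-complement 8≤m ≤-refl ℓ H⊆ℓ))
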